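{- Let $\hat{P}$ be a \textsc{Promela} sketch whose holes are $\texttt{??}_1,\ldots,\texttt{??}_n$, where hole $\texttt{??}_i$ has bounded integer domain $[n_i,n_i']$. Let $\varphi$ be a control function for $\hat{P}$, and let $A_1,\ldots,A_n$ be the numerical features corresponding to the holes $\texttt{??}_1,\ldots,\texttt{??}_n$ (feature $A_i$ has domain $[n_i,n_i']$). Define the configuration $k$ by $k(A_i)=\varphi(\texttt{??}_i)$ for $1\le i\le n$. Let $\overline{P}=\texttt{Rewrite}(\hat{P})$. Then $[\![\hat{P}]\!]^{\varphi}_{TS}$ is equivalent to $[\![\pi_k([\![\overline{P}]\!]_{FTS})]\!]_{TS}$.
   Context: \textsc{Promela} statements are generated by: $stm ::= \texttt{skip} \mid \texttt{break} \mid x := expr \mid c?x \mid c!expr \mid stm_1; stm_2 \mid \texttt{if}::g_1\to stm_1 \cdots ::g_n\to stm_n\ \texttt{fi} \mid \texttt{do}::g_1\to stm_1\cdots::g_n\to stm_n\ \texttt{od}$, with the standard \textsc{Promela} (SPIN) semantics, under which a model denotes a transition system (TS) $(S,I,\mathit{trans},AP,L)$; the semantics $[\![\mathcal{T}]\!]_{TS}$ of a TS is its set of infinite paths starting in an initial state. A sketch is a \textsc{Promela} model that may additionally contain integer holes $\texttt{??}_i$ (expressions), each uniquely labelled and with a bounded integer domain $[n_i,n_i']$. A control function $\varphi$ maps each hole to an integer value; $[\![\hat{P}]\!]^{\varphi}_{TS}$ is the TS of the model obtained by replacing each hole $\texttt{??}_i$ by $\varphi(\texttt{??}_i)$. Model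 families: a finite ordered set $\mathbb{F}$ of numerical features, each $A$ with domain $\mathrm{dom}(A)\subseteq\mathbb{Z}$; a configuration is a valuation $k:\mathbb{F}\to\mathbb{Z}$ with $k(A)\in\mathrm{dom}(A)$. Feature expressions: $\psi ::= \mathrm{true}\mid A\bowtie n\mid\neg\psi\mid\psi\land\psi$ with $\bowtie\in\{=,<\}$, $n\in\mathbb{Z}$. A \textsc{Promela} model family additionally allows the statement $\texttt{\#if}::\psi_1\to stm_1\ldots::\psi_n\to stm_n\ \texttt{\#endif}$ (a compile-time choice: $stm_i$ is included in the variant for configuration $k$ when $k\models\psi_i$). A model family denotes a featured transition system (FTS) $[\![\overline{P}]\!]_{FTS}=(S,I,\mathit{trans},AP,L,\mathbb{F},\mathbb{K},\delta)$, i.e. a TS together with features, a set $\mathbb{K}$ of valid configurations, and a total map $\delta$ labelling each transition with a feature expression (the presence conditions introduced by \texttt{\#if}). The projection $\pi_k(\mathcal{F})$ of an FTS to configuration $k$ is the TS $(S,I,\{t\in\mathit{trans}\mid k\models\delta(t)\},AP,L)$. $\texttt{Rewrite}(\hat{P})$ is the model family obtained by repeatedly applying, until no longer applicable, the rule: a basic (non-compound) statement $stm[\texttt{??}^{[n,n']}]$ containing a hole with domain $[n,n']$ is replaced by $\texttt{\#if}::(A=n)\to stm[n]\ \ldots\ ::(A=n')\to stm[n']\ \texttt{\#endif}$, where $A$ is a fresh numerical feature with domain $[n,n']$; the set $\mathbb{K}$ of valid configurations consists of all combinations of feature values. -}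

module Defs where

open import Data.Nat as ℕ using (ℕ; zero; suc)
open import Data.Integer as ℤ using (ℤ; +_; _≤?_; ∣_∣)
open import Data.Bool using (Bool; if_then_else_)
import Data.Bool
open import Data.Empty using (⊥; ⊥-elim)
open import Data.Unit using (⊤)
open import Data.Fin using (Fin)
open import Data.Fin.Properties using () renaming (_≟_ to _≟ᶠ_)
open import Data.List using (List; []; _∷_; _++_; map; upTo; length; [_])
open import Data.List.Membership.Propositional using (_∈_)
open import Data.Vec as Vec using (Vec; lookup; _[_]≔_)
open import Data.Product using (Σ; _×_; _,_; proj₁; proj₂)
open import Relation.Nullary using (¬_; yes; no)
open import Relation.Nullary.Decidable using (⌊_⌋)
open import Relation.Binary.PropositionalEquality using (_≡_; _≢_)

record Store : Set where
  constructor store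
  field
    vars  : ℕ → ℤ
    chans : ℕ → List ℤ
open Store public

setVar : Store → ℕ → ℤ → Store
setVar σ x v = store (λ y → if ⌊ y ℕ.≟ x ⌋ then v else vars σ y) (chans σ)

setChan : Store → ℕ → List ℤ → Store
setChan σ c q = store (vars σ) (λ d → if ⌊ d ℕ.≟ c ⌋ then q else chans σ d)

-- Expressions, possibly containing holes labelled by elements of H.
-- (H = ⊥ : ordinary, hole-free Promela expressions.)

data Expr (H : Set) : Set where
  con  : ℤ → Expr H
  var  : ℕ → Expr H
  hole : H → Expr H
  add sub mul : Expr H → Expr H → Expr H
  eqE ltE andE : Expr H → Expr H → Expr H
  notE : Expr H → Expr H
  len  : ℕ → Expr H

b2z : Bool → ℤ
b2z Data.Bool.true  = + 1
b2z Data.Bool.false = + 0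

nz : ℤ → Bool
nz (+ zero) = Data.Bool.false
nz _        = Data.Bool.true

eval : Expr ⊥ → Store → ℤ
eval (con n)    σ = n
eval (var x)    σ = vars σ x
eval (hole ())  σ
eval (add e f)  σ = eval e σ ℤ.+ eval f σ
eval (sub e f)  σ = eval e σ ℤ.- eval f σ
eval (mul e f)  σ = eval e σ ℤ.* eval f σ
eval (eqE e f)  σ = b2z ⌊ eval e σ ℤ.≟ eval f σ ⌋
eval (ltE e f)  σ = b2z ⌊ eval e σ ℤ.<? eval f σ ⌋
eval (andE e f) σ = b2z (Data.Bool._∧_ (nz (eval e σ)) (nz (eval f σ)))
eval (notE e)   σ = b2z (Data.Bool.not (nz (eval e σ)))
eval (len c)    σ = + length (chans σ c)

-- Statements.  'g -> stm' is, as in Promela, just 'g ; stm' where the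
-- expression statement 'g' (guard) is executable iff g evaluates to non-zero.

data Basic (H : Set) : Set where
  skip  : Basic H
  asgn  : ℕ → Expr H → Basic H
  recv  : ℕ → ℕ → Basic H
  send  : ℕ → Expr H → Basic H
  guard : Expr H → Basic H

data Stm (H : Set) : Set where
  bas   : Basic H → Stm H
  break : Stm H
  seq   : Stm H → Stm H → Stm H
  ifS   : List (Stm H) → Stm H
  doS   : List (Stm H) → Stm H

data FExp (F : Set) : Set where
  true  : FExp F
  eqF   : F → ℤ → FExp F
  ltF   : F → ℤ → FExp F
  negF  : FExp F → FExp F
  andF  : FExp F → FExp F → FExp F

_⊨_ : {F : Set} → (F → ℤ) → FExp F → Set
k ⊨ true       = ⊤
k ⊨ eqF A n    = k A ≡ n
k ⊨ ltF A n    = k A ℤ.< n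
k ⊨ negF ψ     = ¬ (k ⊨ ψ)
k ⊨ andF ψ ψ'  = (k ⊨ ψ) × (k ⊨ ψ')

-- Family statements: hole-free statements plus the compile-time #if.
data FStm (F : Set) : Set where
  bas   : Basic ⊥ → FStm F
  break : FStm F
  seq   : FStm F → FStm F → FStm F
  ifS   : List (FStm F) → FStm F
  doS   : List (FStm F) → FStm F
  ifdef : List (FExp F × FStm F) → FStm F

record TS : Set₁ where
  field
    State : Set
    Init  : State → Set
    Trans : State → State → Set
    Lab   : State → Store

record FTS : Set₁ where
  field
    State : Set
    Init  : State → Set
    Trans : State → State → Set
    Lab   : State → Store
    nF    : ℕ
    domF  : Fin nF → ℤ × ℤ
    Valid : (Fin nF → ℤ) → Set
    δ     : ∀ {s s'} → Trans s s' → FExp (Fin nF)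

project : (𝓕 : FTS) → (Fin (FTS.nF 𝓕) → ℤ) → TS
project 𝓕 k = record
  { State = FTS.State 𝓕
  ; Init  = FTS.Init 𝓕
  ; Trans = λ s s' → Σ (FTS.Trans 𝓕 s s') (λ t → k ⊨ FTS.δ 𝓕 t)
  ; Lab   = FTS.Lab 𝓕 }

record Path (T : TS) : Set where
  field
    π     : ℕ → TS.State T
    start : TS.Init T (π 0)
    steps : ∀ i → TS.Trans T (π i) (π (suc i))
open Path public

Equivalent : TS → TS → Set
Equivalent T₁ T₂ =
  (∀ (p : Path T₁) → Σ (Path T₂) λ q → ∀ i → TS.Lab T₁ (π p i) ≡ TS.Lab T₂ (π q i)) ×
  (∀ (q : Path T₂) → Σ (Path T₁) λ p → ∀ i → TS.Lab T₁ (π p i) ≡ TS.Lab T₂ (π q i))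

data Lbl : Set where
  τ   : Lbl
  out : ℕ → ℤ → Lbl
  inp : ℕ → ℕ → Lbl

-- cap c = capacity of channel c (0 = rendezvous channel)
data BStep (cap : ℕ → ℕ) : Basic ⊥ → Store → Lbl → Store → Set where
  skipS  : ∀ {σ} → BStep cap skip σ τ σ
  asgnS  : ∀ {σ x e} → BStep cap (asgn x e) σ τ (setVar σ x (eval e σ))
  guardS : ∀ {σ e} → nz (eval e σ) ≡ Data.Bool.true → BStep cap (guard e) σ τ σ
  sendB  : ∀ {σ c e} → 0 ℕ.< cap c → length (chans σ c) ℕ.< cap c →
           BStep cap (send c e) σ τ (setChan σ c (chans σ c ++ [ eval e σ ]))
  recvB  : ∀ {σ c x v q} → 0 ℕ.< cap c → chans σ c ≡ v ∷ q →
           BStep cap (recv c x) σ τ (setChan (setVar σ x v) c q)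
  sendR  : ∀ {σ c e} → cap c ≡ 0 → BStep cap (send c e) σ (out c (eval e σ)) σ
  recvR  : ∀ {σ c x} → cap c ≡ 0 → BStep cap (recv c x) σ (inp c x) σ

-- Process-local control state: a stack of frames.  'iter bs' marks the
-- enclosing do-loop 'do :: bs od' (re-entered when reached, exited by break).
data Frame (S : Set) : Set where
  stm  : S → Frame S
  iter : List S → Frame S

exitLoop : {S : Set} → List (Frame S) → List (Frame S)
exitLoop []            = []
exitLoop (stm _  ∷ K)  = exitLoop K
exitLoop (iter _ ∷ K)  = K

data PStep (cap : ℕ → ℕ) : List (Frame (Stm ⊥)) → Store → Lbl → List (Frame (Stm ⊥)) → Store → Set where
  basS  : ∀ {b K σ l σ'} → BStep cap b σ l σ' → PStep cap (stm (bas b) ∷ K) σ l K σ'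
  brkS  : ∀ {K σ} → PStep cap (stm break ∷ K) σ τ (exitLoop K) σ
  seqS  : ∀ {s₁ s₂ K σ l K' σ'} → PStep cap (stm s₁ ∷ stm s₂ ∷ K) σ l K' σ' →
          PStep cap (stm (seq s₁ s₂) ∷ K) σ l K' σ'
  ifSS  : ∀ {s bs K σ l K' σ'} → s ∈ bs → PStep cap (stm s ∷ K) σ l K' σ' →
          PStep cap (stm (ifS bs) ∷ K) σ l K' σ'
  doSS  : ∀ {s bs K σ l K' σ'} → s ∈ bs → PStep cap (stm s ∷ iter bs ∷ K) σ l K' σ' →
          PStep cap (stm (doS bs) ∷ K) σ l K' σ'
  iterS : ∀ {bs K σ l K' σ'} → PStep cap (stm (doS bs) ∷ K) σ l K' σ' →
          PStep cap (iter bs ∷ K) σ l K' σ'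

data FPStep {F : Set} (cap : ℕ → ℕ) : List (Frame (FStm F)) → Store → Lbl → List (Frame (FStm F)) → Store → FExp F → Set where
  basS  : ∀ {b K σ l σ'} → BStep cap b σ l σ' → FPStep cap (stm (bas b) ∷ K) σ l K σ' true
  brkS  : ∀ {K σ} → FPStep cap (stm break ∷ K) σ τ (exitLoop K) σ true
  seqS  : ∀ {s₁ s₂ K σ l K' σ' ψ} → FPStep cap (stm s₁ ∷ stm s₂ ∷ K) σ l K' σ' ψ →
          FPStep cap (stm (seq s₁ s₂) ∷ K) σ l K' σ' ψ
  ifSS  : ∀ {s bs K σ l K' σ' ψ} → s ∈ bs → FPStep cap (stm s ∷ K) σ l K' σ' ψ →
          FPStep cap (stm (ifS bs) ∷ K) σ l K' σ' ψ
  doSS  : ∀ {s bs K σ l K' σ' ψ} → s ∈ bs → FPStep cap (stm s ∷ iter bs ∷ K) σ l K' σ' ψ →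
          FPStep cap (stm (doS bs) ∷ K) σ l K' σ' ψ
  iterS : ∀ {bs K σ l K' σ' ψ} → FPStep cap (stm (doS bs) ∷ K) σ l K' σ' ψ →
          FPStep cap (iter bs ∷ K) σ l K' σ' ψ
  ifdefS : ∀ {φ s bs K σ l K' σ' ψ} → (φ , s) ∈ bs → FPStep cap (stm s ∷ K) σ l K' σ' ψ →
          FPStep cap (stm (ifdef bs) ∷ K) σ l K' σ' (andF φ ψ)

GState : ℕ → Set → Set
GState m S = Vec (List (Frame S)) m × Store

data GStep {m : ℕ} (cap : ℕ → ℕ) : GState m (Stm ⊥) → GState m (Stm ⊥) → Set where
  local : ∀ {ps σ K σ'} (i : Fin m) → PStep cap (lookup ps i) σ τ K σ' →
          GStep cap (ps , σ) (ps [ i ]≔ K , σ')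
  rdv   : ∀ {ps σ c v x Ki Kj} (i j : Fin m) → i ≢ j → cap c ≡ 0 →
          PStep cap (lookup ps i) σ (out c v) Ki σ →
          PStep cap (lookup ps j) σ (inp c x) Kj σ →
          GStep cap (ps , σ) ((ps [ i ]≔ Ki) [ j ]≔ Kj , setVar σ x v)

data FGStep {F : Set} {m : ℕ} (cap : ℕ → ℕ) : GState m (FStm F) → FExp F → GState m (FStm F) → Set where
  local : ∀ {ps σ K σ' ψ} (i : Fin m) → FPStep cap (lookup ps i) σ τ K σ' ψ →
          FGStep cap (ps , σ) ψ (ps [ i ]≔ K , σ')
  rdv   : ∀ {ps σ c v x Ki Kj ψ ψ'} (i j : Fin m) → i ≢ j → cap c ≡ 0 →
          FPStep cap (lookup ps i) σ (out c v) Ki σ ψ →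
          FPStep cap (lookup ps j) σ (inp c x) Kj σ ψ' →
          FGStep cap (ps , σ) (andF ψ ψ') ((ps [ i ]≔ Ki) [ j ]≔ Kj , setVar σ x v)

record Model : Set where
  field
    m     : ℕ
    procs : Vec (Stm ⊥) m
    init  : Store
    cap   : ℕ → ℕ

⟦_⟧TS : Model → TS
⟦ M ⟧TS = record
  { State = GState (Model.m M) (Stm ⊥)
  ; Init  = λ s → s ≡ (Vec.map (λ p → stm p ∷ []) (Model.procs M) , Model.init M)
  ; Trans = GStep (Model.cap M)
  ; Lab   = proj₂ }

record Sketch : Set where
  field
    n     : ℕ
    dom   : Fin n → ℤ × ℤ
    m     : ℕ
    procs : Vec (Stm (Fin n)) m
    init  : Store
    cap   : ℕ → ℕ

record Family : Set where
  field
    nF    : ℕ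
    domF  : Fin nF → ℤ × ℤ
    m     : ℕ
    procs : Vec (FStm (Fin nF)) m
    init  : Store
    cap   : ℕ → ℕ

InDom : ℤ × ℤ → ℤ → Set
InDom (lo , hi) v = (lo ℤ.≤ v) × (v ℤ.≤ hi)

⟦_⟧FTS : Family → FTS
⟦ P ⟧FTS = record
  { State = GState (Family.m P) (FStm (Fin (Family.nF P)))
  ; Init  = λ s → s ≡ (Vec.map (λ p → stm p ∷ []) (Family.procs P) , Family.init P)
  ; Trans = λ s s' → Σ (FExp (Fin (Family.nF P))) (λ ψ → FGStep (Family.cap P) s ψ s')
  ; Lab   = proj₂
  ; nF    = Family.nF P
  ; domF  = Family.domF P
  ; Valid = λ k → ∀ A → InDom (Family.domF P A) (k A)
  ; δ     = proj₁ }

module _ {H : Set} where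
  holesE : Expr H → List H
  holesE (con _)    = []
  holesE (var _)    = []
  holesE (hole h)   = h ∷ []
  holesE (add e f)  = holesE e ++ holesE f
  holesE (sub e f)  = holesE e ++ holesE f
  holesE (mul e f)  = holesE e ++ holesE f
  holesE (eqE e f)  = holesE e ++ holesE f
  holesE (ltE e f)  = holesE e ++ holesE f
  holesE (andE e f) = holesE e ++ holesE f
  holesE (notE e)   = holesE e
  holesE (len _)    = []

  holesB : Basic H → List H
  holesB skip       = []
  holesB (asgn _ e) = holesE e
  holesB (recv _ _) = []
  holesB (send _ e) = holesE e
  holesB (guard e)  = holesE e

  mutual
    holesS : Stm H → List H
    holesS (bas b)     = holesB b
    holesS break       = []
    holesS (seq s t)   = holesS s ++ holesS t
    holesS (ifS bs)    = holesL bs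
    holesS (doS bs)    = holesL bs

    holesL : List (Stm H) → List H
    holesL []       = []
    holesL (s ∷ bs) = holesS s ++ holesL bs

  holesP : {m : ℕ} → Vec (Stm H) m → List H
  holesP Vec.[]       = []
  holesP (s Vec.∷ ps) = holesS s ++ holesP ps

  module _ (φ : H → ℤ) where
    fillE : Expr H → Expr ⊥
    fillE (con n)    = con n
    fillE (var x)    = var x
    fillE (hole h)   = con (φ h)
    fillE (add e f)  = add (fillE e) (fillE f)
    fillE (sub e f)  = sub (fillE e) (fillE f)
    fillE (mul e f)  = mul (fillE e) (fillE f)
    fillE (eqE e f)  = eqE (fillE e) (fillE f)
    fillE (ltE e f)  = ltE (fillE e) (fillE f)
    fillE (andE e f) = andE (fillE e) (fillE f)
    fillE (notE e)   = notE (fillE e)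
    fillE (len c)    = len c

    fillB : Basic H → Basic ⊥
    fillB skip       = skip
    fillB (asgn x e) = asgn x (fillE e)
    fillB (recv c x) = recv c x
    fillB (send c e) = send c (fillE e)
    fillB (guard e)  = guard (fillE e)

    mutual
      fillS : Stm H → Stm ⊥
      fillS (bas b)   = bas (fillB b)
      fillS break     = break
      fillS (seq s t) = seq (fillS s) (fillS t)
      fillS (ifS bs)  = ifS (fillL bs)
      fillS (doS bs)  = doS (fillL bs)

      fillL : List (Stm H) → List (Stm ⊥)
      fillL []       = []
      fillL (s ∷ bs) = fillS s ∷ fillL bs

ControlFunction : (P : Sketch) → (Fin (Sketch.n P) → ℤ) → Set
ControlFunction P φ = ∀ i → InDom (Sketch.dom P i) (φ i)

fillSketch : (P : Sketch) → (Fin (Sketch.n P) → ℤ) → Model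
fillSketch P φ = record
  { m = Sketch.m P
  ; procs = Vec.map (fillS φ) (Sketch.procs P)
  ; init = Sketch.init P
  ; cap = Sketch.cap P }

⟦_⟧TS^_ : (P : Sketch) → (Fin (Sketch.n P) → ℤ) → TS
⟦ P ⟧TS^ φ = ⟦ fillSketch P φ ⟧TS

-- Rewrite.  The feature introduced for hole ??_i is A_i (= i : Fin n),
-- with domain dom(??_i); holes are unique, so this feature is fresh.

range : ℤ → ℤ → List ℤ
range a b with a ℤ.≤? b
... | yes _ = map (λ i → a ℤ.+ + i) (upTo (suc ∣ b ℤ.- a ∣))
... | no  _ = []

module _ {n : ℕ} (dom : Fin n → ℤ × ℤ) where
  upd : (Fin n → ℤ) → Fin n → ℤ → Fin n → ℤ
  upd ρ h v j = if ⌊ j ≟ᶠ h ⌋ then v else ρ j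

  -- rwB b ρ hs : rewrite the holes hs of basic statement b one after the
  -- other (left to right), ρ recording the values substituted so far.
  rwB : Basic (Fin n) → (Fin n → ℤ) → List (Fin n) → FStm (Fin n)
  rwB b ρ []       = bas (fillB ρ b)
  rwB b ρ (h ∷ hs) =
    ifdef (map (λ v → (eqF h v , rwB b (upd ρ h v) hs)) (range (proj₁ (dom h)) (proj₂ (dom h))))

  mutual
    rwS : Stm (Fin n) → FStm (Fin n)
    rwS (bas b)   = rwB b (λ _ → + 0) (holesB b)   -- initial ρ is irrelevant
    rwS break     = break
    rwS (seq s t) = seq (rwS s) (rwS t)
    rwS (ifS bs)  = ifS (rwL bs)
    rwS (doS bs)  = doS (rwL bs)

    rwL : List (Stm (Fin n)) → List (FStm (Fin n))
    rwL []       = []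
    rwL (s ∷ bs) = rwS s ∷ rwL bs

Rewrite : Sketch → Family
Rewrite P = record
  { nF = Sketch.n P
  ; domF = Sketch.dom P
  ; m = Sketch.m P
  ; procs = Vec.map (rwS (Sketch.dom P)) (Sketch.procs P)
  ; init = Sketch.init P
  ; cap = Sketch.cap P }

module Submission where

open import Defs
open import Data.Fin using (Fin)
open import Data.Integer using (ℤ)
open import Data.List using (allFin)
open import Data.List.Relation.Binary.Permutation.Propositional using (_↭_)
open import Relation.Binary.PropositionalEquality using (_≡_)

import Data.Fin as Fin
open import Data.Nat as ℕ using (ℕ; zero; suc)
import Data.Integer as ℤ
open import Data.Integer using (+_; ∣_∣)
import Data.Integer.Properties as ℤ
open import Data.Empty using (⊥; ⊥-elim)
open import Data.Unit using (tt)
open import Data.Fin.Properties using () renaming (_≟_ to _≟ᶠ_)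
open import Data.List using (List; []; _∷_; _++_; map)
open import Data.List.Membership.Propositional using (_∈_)
open import Data.List.Membership.Propositional.Properties
  using (∈-map⁺; ∈-map⁻; ∈-upTo⁺; ∈-++⁺ˡ; ∈-++⁺ʳ)
open import Data.List.Relation.Unary.Any using (here; there)
open import Data.List.Relation.Binary.Pointwise using (Pointwise; []; _∷_)
open import Data.Vec.Relation.Binary.Pointwise.Inductive as Vecᴾ using ([]; _∷_)
open import Data.Vec as Vec using (Vec; _[_]≔_)
open import Data.Product using (Σ; _×_; _,_; proj₁; proj₂)
open import Data.Sum using (_⊎_; inj₁; inj₂; [_,_]′)
open import Function using (id; flip)
open import Relation.Nullary using (yes; no)
open import Relation.Binary.PropositionalEquality
  using (refl; sym; trans; cong; cong₂; subst; module ≡-Reasoning)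

-- Filling the holes of a basic statement with φ
-- and resolving the #if-cascade that Rewrite builds for it under k produce the
-- same statement, so the process stacks of the filled sketch and of the family
-- correspond frame by frame.  This correspondence is a bisimulation between
-- the filled model and the projection of the FTS that preserves the data
-- state, and the path semantics of bisimilar systems coincide.

record Simulation (T₁ T₂ : TS) : Set₁ where
  field
    _∼_    : TS.State T₁ → TS.State T₂ → Set
    ∼-lab  : ∀ {s t} → s ∼ t → TS.Lab T₁ s ≡ TS.Lab T₂ t
    ∼-init : ∀ {s} → TS.Init T₁ s → Σ (TS.State T₂) λ t → TS.Init T₂ t × s ∼ t
    ∼-step : ∀ {s t s′} → s ∼ t → TS.Trans T₁ s s′ →
             Σ (TS.State T₂) λ t′ → TS.Trans T₂ t t′ × s′ ∼ t′

module _ {T₁ T₂ : TS} (S : Simulation T₁ T₂) where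
  open Simulation S

  simulate-path : (p : Path T₁) → Σ (Path T₂) λ q → ∀ i → TS.Lab T₁ (π p i) ≡ TS.Lab T₂ (π q i)
  simulate-path p = q , λ i → ∼-lab (proj₂ (match i))
    where
    match : ∀ i → Σ (TS.State T₂) (π p i ∼_)
    match zero    = let t , _ , s∼t = ∼-init (start p) in t , s∼t
    match (suc i) = let t′ , _ , s′∼t′ = ∼-step (proj₂ (match i)) (steps p i) in t′ , s′∼t′

    q : Path T₂
    q = record
      { π     = λ i → proj₁ (match i)
      ; start = proj₁ (proj₂ (∼-init (start p)))
      ; steps = λ i → proj₁ (proj₂ (∼-step (proj₂ (match i)) (steps p i)))
      }

simulations⇒equivalent : {T₁ T₂ : TS} → Simulation T₁ T₂ → Simulation T₂ T₁ → Equivalent T₁ T₂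
simulations⇒equivalent S S′ = simulate-path S , λ q →
  let p , same = simulate-path S′ q in p , λ i → sym (same i)

∈-range : ∀ {lo hi v} → lo ℤ.≤ v → v ℤ.≤ hi → v ∈ range lo hi
∈-range {lo} {hi} {v} lo≤v v≤hi with lo ℤ.≤? hi
... | no lo≰hi = ⊥-elim (lo≰hi (ℤ.≤-trans lo≤v v≤hi))
... | yes _    = subst (_∈ _) lo+[v-lo]≡v (∈-map⁺ (λ i → lo ℤ.+ + i) (∈-upTo⁺ (ℕ.s≤s ∣v-lo∣≤∣hi-lo∣)))
  where
  open ≡-Reasoning

  ∣v-lo∣ : + ∣ v ℤ.- lo ∣ ≡ v ℤ.- lo
  ∣v-lo∣ = ℤ.0≤i⇒+∣i∣≡i (ℤ.i≤j⇒0≤j-i lo≤v)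

  ∣hi-lo∣ : + ∣ hi ℤ.- lo ∣ ≡ hi ℤ.- lo
  ∣hi-lo∣ = ℤ.0≤i⇒+∣i∣≡i (ℤ.i≤j⇒0≤j-i (ℤ.≤-trans lo≤v v≤hi))

  ∣v-lo∣≤∣hi-lo∣ : ∣ v ℤ.- lo ∣ ℕ.≤ ∣ hi ℤ.- lo ∣
  ∣v-lo∣≤∣hi-lo∣ = ℤ.drop‿+≤+ (subst (ℤ._≤ _) (sym ∣v-lo∣) (subst (_ ℤ.≤_) (sym ∣hi-lo∣)
                    (ℤ.+-monoˡ-≤ (ℤ.- lo) v≤hi)))

  lo+[v-lo]≡v : lo ℤ.+ + ∣ v ℤ.- lo ∣ ≡ v
  lo+[v-lo]≡v = begin
    lo ℤ.+ + ∣ v ℤ.- lo ∣   ≡⟨ cong (λ x → lo ℤ.+ x) ∣v-lo∣ ⟩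
    lo ℤ.+ (v ℤ.- lo)       ≡⟨ ℤ.+-comm lo (v ℤ.- lo) ⟩
    v ℤ.- lo ℤ.+ lo         ≡⟨ ℤ.+-assoc v (ℤ.- lo) lo ⟩
    v ℤ.+ (ℤ.- lo ℤ.+ lo)   ≡⟨ cong (λ x → v ℤ.+ x) (ℤ.+-inverseˡ lo) ⟩
    v ℤ.+ + 0               ≡⟨ ℤ.+-identityʳ v ⟩
    v                       ∎

[]≔⁺ : ∀ {A B : Set} {R : A → B → Set} {m} {xs : Vec A m} {ys : Vec B m} {x y} (i : Fin m) →
       Vecᴾ.Pointwise R xs ys → R x y → Vecᴾ.Pointwise R (xs [ i ]≔ x) (ys [ i ]≔ y)
[]≔⁺ Fin.zero    (_   ∷ rs) r = r ∷ rs
[]≔⁺ (Fin.suc i) (r′ ∷ rs) r = r′ ∷ []≔⁺ i rs r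

module _ {H : Set} (ρ ρ′ : H → ℤ) where
  private
    Agree : List H → Set
    Agree hs = ∀ h → h ∈ hs → ρ h ≡ ρ′ h

    agreeˡ : ∀ e f → Agree (holesE e ++ holesE f) → Agree (holesE e)
    agreeˡ e f ag h h∈ = ag h (∈-++⁺ˡ h∈)

    agreeʳ : ∀ e f → Agree (holesE e ++ holesE f) → Agree (holesE f)
    agreeʳ e f ag h h∈ = ag h (∈-++⁺ʳ (holesE e) h∈)

  fillE-cong : ∀ e → Agree (holesE e) → fillE ρ e ≡ fillE ρ′ e
  fillE-cong (con _)    _  = refl
  fillE-cong (var _)    _  = refl
  fillE-cong (hole h)   ag = cong con (ag h (here refl))
  fillE-cong (add e f)  ag = cong₂ add  (fillE-cong e (agreeˡ e f ag)) (fillE-cong f (agreeʳ e f ag))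
  fillE-cong (sub e f)  ag = cong₂ sub  (fillE-cong e (agreeˡ e f ag)) (fillE-cong f (agreeʳ e f ag))
  fillE-cong (mul e f)  ag = cong₂ mul  (fillE-cong e (agreeˡ e f ag)) (fillE-cong f (agreeʳ e f ag))
  fillE-cong (eqE e f)  ag = cong₂ eqE  (fillE-cong e (agreeˡ e f ag)) (fillE-cong f (agreeʳ e f ag))
  fillE-cong (ltE e f)  ag = cong₂ ltE  (fillE-cong e (agreeˡ e f ag)) (fillE-cong f (agreeʳ e f ag))
  fillE-cong (andE e f) ag = cong₂ andE (fillE-cong e (agreeˡ e f ag)) (fillE-cong f (agreeʳ e f ag))
  fillE-cong (notE e)   ag = cong notE (fillE-cong e ag)
  fillE-cong (len _)    _  = refl


  fillB-cong : ∀ b → Agree (holesB b) → fillB ρ b ≡ fillB ρ′ b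
  fillB-cong skip       _  = refl
  fillB-cong (asgn x e) ag = cong (asgn x) (fillE-cong e ag)
  fillB-cong (recv c x) _  = refl
  fillB-cong (send c e) ag = cong (send c) (fillE-cong e ag)
  fillB-cong (guard e)  ag = cong guard (fillE-cong e ag)

module _ {H : Set} (φ : H → ℤ) where
  fillL≡map : ∀ bs → fillL φ bs ≡ map (fillS φ) bs
  fillL≡map []       = refl
  fillL≡map (s ∷ bs) = cong (fillS φ s ∷_) (fillL≡map bs)

module _ {n : ℕ} (dom : Fin n → ℤ × ℤ) where
  rwL≡map : ∀ bs → rwL dom bs ≡ map (rwS dom) bs
  rwL≡map []       = refl
  rwL≡map (s ∷ bs) = cong (rwS dom s ∷_) (rwL≡map bs)

module Correspondence (P : Sketch) (φ : Fin (Sketch.n P) → ℤ) (φ∈dom : ControlFunction P φ)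
                      (k : Fin (Sketch.n P) → ℤ) (k≡φ : ∀ i → k i ≡ φ i) where
  open Sketch P using (n; dom; m; procs; cap)

  -- Invariant of the #if-cascade rwB b ρ hs: every hole of b is still pending
  -- in hs or has already been given its φ-value in ρ.
  Settled : Basic (Fin n) → (Fin n → ℤ) → List (Fin n) → Set
  Settled b ρ hs = ∀ h → h ∈ holesB b → h ∈ hs ⊎ ρ h ≡ φ h

  all-pending : ∀ b ρ → Settled b ρ (holesB b)
  all-pending b ρ h h∈b = inj₁ h∈b

  settled-upd : ∀ {b ρ h hs v} → v ≡ φ h → Settled b ρ (h ∷ hs) → Settled b (upd dom ρ h v) hs
  settled-upd {h = h} v≡φh settled h′ h′∈b with h′ ≟ᶠ h | settled h′ h′∈b
  ... | yes refl | _                 = inj₂ v≡φh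
  ... | no h′≢h  | inj₁ (here h′≡h)  = ⊥-elim (h′≢h h′≡h)
  ... | no _     | inj₁ (there h′∈hs) = inj₁ h′∈hs
  ... | no _     | inj₂ ρh′≡φh′      = inj₂ ρh′≡φh′

  settled-fill : ∀ {b ρ} → Settled b ρ [] → fillB ρ b ≡ fillB φ b
  settled-fill {b} {ρ} settled = fillB-cong ρ φ b λ h h∈b → [ (λ ()) , id ]′ (settled h h∈b)

  fillB-step⇒rwB-step : ∀ {b ρ hs K σ l σ′} → Settled b ρ hs → BStep cap (fillB φ b) σ l σ′ →
                        Σ (FExp (Fin n)) λ ψ → FPStep cap (stm (rwB dom b ρ hs) ∷ K) σ l K σ′ ψ × k ⊨ ψ
  fillB-step⇒rwB-step {hs = []} settled step =
    true , basS (subst (λ b′ → BStep cap b′ _ _ _) (sym (settled-fill settled)) step) , tt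
  fillB-step⇒rwB-step {b} {ρ} {h ∷ hs} settled step =
    let ψ , fstep , k⊨ψ = fillB-step⇒rwB-step (settled-upd {b} refl settled) step
    in  andF (eqF h (φ h)) ψ , ifdefS φh-branch fstep , k≡φ h , k⊨ψ
    where
    φh-branch : (eqF h (φ h) , rwB dom b (upd dom ρ h (φ h)) hs) ∈
                map (λ v → eqF h v , rwB dom b (upd dom ρ h v) hs) (range (proj₁ (dom h)) (proj₂ (dom h)))
    φh-branch = ∈-map⁺ (λ v → eqF h v , rwB dom b (upd dom ρ h v) hs) (∈-range (proj₁ (φ∈dom h)) (proj₂ (φ∈dom h)))

  rwB-step⇒fillB-step : ∀ {b ρ hs K K′ σ l σ′ ψ} → Settled b ρ hs →
                        FPStep cap (stm (rwB dom b ρ hs) ∷ K) σ l K′ σ′ ψ → k ⊨ ψ →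
                        K′ ≡ K × BStep cap (fillB φ b) σ l σ′
  rwB-step⇒fillB-step {hs = []} settled (basS step) _ =
    refl , subst (λ b′ → BStep cap b′ _ _ _) (settled-fill settled) step
  rwB-step⇒fillB-step {b} {ρ} {h ∷ hs} settled (ifdefS branch∈ fstep) (kh≡v , k⊨ψ)
    with ∈-map⁻ (λ v → eqF h v , rwB dom b (upd dom ρ h v) hs) branch∈
  ... | v , _ , refl = rwB-step⇒fillB-step (settled-upd {b} (trans (sym kh≡v) (k≡φ h)) settled) fstep k⊨ψ

  data FrameRel : Frame (Stm ⊥) → Frame (FStm (Fin n)) → Set where
    stmR  : ∀ s  → FrameRel (stm (fillS φ s)) (stm (rwS dom s))
    iterR : ∀ bs → FrameRel (iter (fillL φ bs)) (iter (rwL dom bs))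

  StackRel : List (Frame (Stm ⊥)) → List (Frame (FStm (Fin n))) → Set
  StackRel = Pointwise FrameRel

  exitLoop-rel : ∀ {K KF} → StackRel K KF → StackRel (exitLoop K) (exitLoop KF)
  exitLoop-rel []               = []
  exitLoop-rel (stmR _  ∷ rest) = exitLoop-rel rest
  exitLoop-rel (iterR _ ∷ rest) = rest

  ∈-fillL⁻ : ∀ {s′} bs → s′ ∈ fillL φ bs → Σ (Stm (Fin n)) λ s → s ∈ bs × s′ ≡ fillS φ s
  ∈-fillL⁻ bs s′∈ = ∈-map⁻ (fillS φ) (subst (_ ∈_) (fillL≡map φ bs) s′∈)

  ∈-fillL⁺ : ∀ {s} bs → s ∈ bs → fillS φ s ∈ fillL φ bs
  ∈-fillL⁺ bs s∈ = subst (_ ∈_) (sym (fillL≡map φ bs)) (∈-map⁺ (fillS φ) s∈)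

  ∈-rwL⁻ : ∀ {s′} bs → s′ ∈ rwL dom bs → Σ (Stm (Fin n)) λ s → s ∈ bs × s′ ≡ rwS dom s
  ∈-rwL⁻ bs s′∈ = ∈-map⁻ (rwS dom) (subst (_ ∈_) (rwL≡map dom bs) s′∈)

  ∈-rwL⁺ : ∀ {s} bs → s ∈ bs → rwS dom s ∈ rwL dom bs
  ∈-rwL⁺ bs s∈ = subst (_ ∈_) (sym (rwL≡map dom bs)) (∈-map⁺ (rwS dom) s∈)

  pstep⇒fpstep : ∀ {K KF σ l K′ σ′} → StackRel K KF → PStep cap K σ l K′ σ′ →
                 Σ _ λ KF′ → Σ (FExp (Fin n)) λ ψ → FPStep cap KF σ l KF′ σ′ ψ × k ⊨ ψ × StackRel K′ KF′
  pstep⇒fpstep (stmR (bas b) ∷ rest) (basS step) =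
    let ψ , fstep , k⊨ψ = fillB-step⇒rwB-step (all-pending b _) step in _ , ψ , fstep , k⊨ψ , rest
  pstep⇒fpstep (stmR break ∷ rest) brkS = _ , true , brkS , tt , exitLoop-rel rest
  pstep⇒fpstep (stmR (seq s t) ∷ rest) (seqS step) =
    let KF′ , ψ , fstep , k⊨ψ , rel = pstep⇒fpstep (stmR s ∷ stmR t ∷ rest) step
    in  KF′ , ψ , seqS fstep , k⊨ψ , rel
  pstep⇒fpstep (stmR (ifS bs) ∷ rest) (ifSS s′∈ step) with ∈-fillL⁻ bs s′∈
  ... | s , s∈ , refl =
    let KF′ , ψ , fstep , k⊨ψ , rel = pstep⇒fpstep (stmR s ∷ rest) step
    in  KF′ , ψ , ifSS (∈-rwL⁺ bs s∈) fstep , k⊨ψ , rel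
  pstep⇒fpstep (stmR (doS bs) ∷ rest) (doSS s′∈ step) with ∈-fillL⁻ bs s′∈
  ... | s , s∈ , refl =
    let KF′ , ψ , fstep , k⊨ψ , rel = pstep⇒fpstep (stmR s ∷ iterR bs ∷ rest) step
    in  KF′ , ψ , doSS (∈-rwL⁺ bs s∈) fstep , k⊨ψ , rel
  pstep⇒fpstep (iterR bs ∷ rest) (iterS step) =
    let KF′ , ψ , fstep , k⊨ψ , rel = pstep⇒fpstep (stmR (doS bs) ∷ rest) step
    in  KF′ , ψ , iterS fstep , k⊨ψ , rel

  fpstep⇒pstep : ∀ {K KF σ l KF′ σ′ ψ} → StackRel K KF → FPStep cap KF σ l KF′ σ′ ψ → k ⊨ ψ →
                 Σ _ λ K′ → PStep cap K σ l K′ σ′ × StackRel K′ KF′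
  fpstep⇒pstep (stmR (bas b) ∷ rest) fstep k⊨ψ with rwB-step⇒fillB-step (all-pending b _) fstep k⊨ψ
  ... | refl , step = _ , basS step , rest
  fpstep⇒pstep (stmR break ∷ rest) brkS _ = _ , brkS , exitLoop-rel rest
  fpstep⇒pstep (stmR (seq s t) ∷ rest) (seqS fstep) k⊨ψ =
    let K′ , step , rel = fpstep⇒pstep (stmR s ∷ stmR t ∷ rest) fstep k⊨ψ in K′ , seqS step , rel
  fpstep⇒pstep (stmR (ifS bs) ∷ rest) (ifSS s′∈ fstep) k⊨ψ with ∈-rwL⁻ bs s′∈
  ... | s , s∈ , refl =
    let K′ , step , rel = fpstep⇒pstep (stmR s ∷ rest) fstep k⊨ψ in K′ , ifSS (∈-fillL⁺ bs s∈) step , rel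
  fpstep⇒pstep (stmR (doS bs) ∷ rest) (doSS s′∈ fstep) k⊨ψ with ∈-rwL⁻ bs s′∈
  ... | s , s∈ , refl =
    let K′ , step , rel = fpstep⇒pstep (stmR s ∷ iterR bs ∷ rest) fstep k⊨ψ
    in  K′ , doSS (∈-fillL⁺ bs s∈) step , rel
  fpstep⇒pstep (iterR bs ∷ rest) (iterS fstep) k⊨ψ =
    let K′ , step , rel = fpstep⇒pstep (stmR (doS bs) ∷ rest) fstep k⊨ψ in K′ , iterS step , rel

  data GlobalRel : GState m (Stm ⊥) → GState m (FStm (Fin n)) → Set where
    globalRel : ∀ {ps qs σ} → Vecᴾ.Pointwise StackRel ps qs → GlobalRel (ps , σ) (qs , σ)

  globalRel-lab : ∀ {s f} → GlobalRel s f → proj₂ s ≡ proj₂ f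
  globalRel-lab (globalRel _) = refl

  initial-rel : ∀ {m′} (ps : Vec (Stm (Fin n)) m′) →
                Vecᴾ.Pointwise StackRel (Vec.map (λ p → stm p ∷ []) (Vec.map (fillS φ) ps))
                                        (Vec.map (λ p → stm p ∷ []) (Vec.map (rwS dom) ps))
  initial-rel Vec.[]       = []
  initial-rel (p Vec.∷ ps) = (stmR p ∷ []) ∷ initial-rel ps

  FamilyStep : GState m (FStm (Fin n)) → GState m (FStm (Fin n)) → Set
  FamilyStep = TS.Trans (project ⟦ Rewrite P ⟧FTS k)

  gstep⇒fgstep : ∀ {s s′ f} → GlobalRel s f → GStep cap s s′ → Σ _ λ f′ → FamilyStep f f′ × GlobalRel s′ f′
  gstep⇒fgstep (globalRel rel) (local i step) =
    let _ , ψ , fstep , k⊨ψ , relᵢ = pstep⇒fpstep (Vecᴾ.lookup rel i) step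
    in  _ , ((ψ , local i fstep) , k⊨ψ) , globalRel ([]≔⁺ i rel relᵢ)
  gstep⇒fgstep (globalRel rel) (rdv i j i≢j rendezvous stepᵢ stepⱼ) =
    let _ , ψᵢ , fstepᵢ , k⊨ψᵢ , relᵢ = pstep⇒fpstep (Vecᴾ.lookup rel i) stepᵢ
        _ , ψⱼ , fstepⱼ , k⊨ψⱼ , relⱼ = pstep⇒fpstep (Vecᴾ.lookup rel j) stepⱼ
    in  _ , ((andF ψᵢ ψⱼ , rdv i j i≢j rendezvous fstepᵢ fstepⱼ) , k⊨ψᵢ , k⊨ψⱼ) ,
        globalRel ([]≔⁺ j ([]≔⁺ i rel relᵢ) relⱼ)

  fgstep⇒gstep : ∀ {s f f′} → GlobalRel s f → FamilyStep f f′ → Σ _ λ s′ → GStep cap s s′ × GlobalRel s′ f′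
  fgstep⇒gstep (globalRel rel) ((_ , local i fstep) , k⊨ψ) =
    let _ , step , relᵢ = fpstep⇒pstep (Vecᴾ.lookup rel i) fstep k⊨ψ
    in  _ , local i step , globalRel ([]≔⁺ i rel relᵢ)
  fgstep⇒gstep (globalRel rel) ((_ , rdv i j i≢j rendezvous fstepᵢ fstepⱼ) , k⊨ψᵢ , k⊨ψⱼ) =
    let _ , stepᵢ , relᵢ = fpstep⇒pstep (Vecᴾ.lookup rel i) fstepᵢ k⊨ψᵢ
        _ , stepⱼ , relⱼ = fpstep⇒pstep (Vecᴾ.lookup rel j) fstepⱼ k⊨ψⱼ
    in  _ , rdv i j i≢j rendezvous stepᵢ stepⱼ , globalRel ([]≔⁺ j ([]≔⁺ i rel relᵢ) relⱼ)

  filled⊑projected : Simulation (⟦ P ⟧TS^ φ) (project ⟦ Rewrite P ⟧FTS k)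
  filled⊑projected = record
    { _∼_    = GlobalRel
    ; ∼-lab  = globalRel-lab
    ; ∼-init = λ { refl → _ , refl , globalRel (initial-rel procs) }
    ; ∼-step = gstep⇒fgstep
    }

  projected⊑filled : Simulation (project ⟦ Rewrite P ⟧FTS k) (⟦ P ⟧TS^ φ)
  projected⊑filled = record
    { _∼_    = flip GlobalRel
    ; ∼-lab  = λ rel → sym (globalRel-lab rel)
    ; ∼-init = λ { refl → _ , refl , globalRel (initial-rel procs) }
    ; ∼-step = fgstep⇒gstep
    }

theorem2 : (P : Sketch) →
           holesP (Sketch.procs P) ↭ allFin (Sketch.n P) →
           (φ : Fin (Sketch.n P) → ℤ) → ControlFunction P φ →
           (k : Fin (Sketch.n P) → ℤ) → (∀ i → k i ≡ φ i) →
           Equivalent (⟦ P ⟧TS^ φ) (project ⟦ Rewrite P ⟧FTS k)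
theorem2 P _ φ φ∈dom k k≡φ = simulations⇒equivalent filled⊑projected projected⊑filled
  where open Correspondence P φ φ∈dom k k≡φ
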